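{- For $n\in\mathbb{Z}_{\ge0}$ and $r\in\mathbb{N}$, $$B_n(x)=\sum_{k=0}^{r-1}\frac{\binom{r}{k}}{r!\binom{n+r-k}{r-k}}\sum_{j=0}^r\binom{r}{j}(-1)^{r-j}B_{n+r-k}(j)\,B_k^{(r)}(x)+\sum_{k=r}^{n}\frac{\binom{n}{k-r}}{r!\binom{k}{r}}\sum_{j=0}^r\binom{r}{j}(-1)^{r-j}B_{n+r-k}(j)\,B_k^{(r)}(x).$$
   Context: The Bernoulli polynomials are defined by $\frac{te^{xt}}{e^t-1}=\sum_{n\ge0}B_n(x)\frac{t^n}{n!}$, and the Bernoulli polynomials of order $r$ by $\left(\frac{t}{e^t-1}\right)^r e^{xt}=\sum_{n\ge0}B_n^{(r)}(x)\frac{t^n}{n!}$. A sum whose upper limit is smaller than its lower limit is empty. -}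

module Defs where

open import Data.Nat using (ℕ; zero; suc; _∸_; _≤?_; _!) renaming (_+_ to _+ℕ_; _*_ to _*ℕ_)
open import Data.Nat.Combinatorics using (_C_)
open import Data.Integer using (+_)
open import Data.Bool using (if_then_else_)
open import Relation.Nullary.Decidable using (⌊_⌋)
open import Data.Rational using (ℚ; 0ℚ; 1ℚ; _+_; _*_; -_; _/_)

sumBelow : ℕ → (ℕ → ℚ) → ℚ
sumBelow zero    f = 0ℚ
sumBelow (suc n) f = sumBelow n f + f n

-- ∑_{i=a}^{b} f i  (empty when b < a)
sumFromTo : ℕ → ℕ → (ℕ → ℚ) → ℚ
sumFromTo a b f = sumBelow (suc b ∸ a) (λ i → f (a +ℕ i))

-- natural-number fraction m / d as a rational (only used with d ≠ 0; m / 0 := 0)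
infix 8 _÷_
_÷_ : ℕ → ℕ → ℚ
m ÷ zero  = 0ℚ
m ÷ suc d = (+ m) / suc d

pow : ℚ → ℕ → ℚ
pow x zero    = 1ℚ
pow x (suc n) = x * pow x n

sign : ℕ → ℚ
sign n = pow (- 1ℚ) n

-- Bernoulli numbers B_n: exponential-generating-function coefficients of t/(e^t-1).
-- Since (e^t-1)/t = ∑_m t^m/(m+1)!, the product being 1 means
--   ∑_{k=0}^{N} C(N,k) B_k / (N-k+1) = [N = 0],
-- i.e. B_0 = 1 and B_N = - ∑_{k=0}^{N-1} C(N,k) B_k / (N-k+1).
-- bernTable n m is B_m for every m ≤ n.
bernTable : ℕ → ℕ → ℚ
bernTable zero    m = 1ℚ
bernTable (suc n) m =
  if ⌊ m ≤? n ⌋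
  then bernTable n m
  else - sumBelow (suc n) (λ k → (((suc n) C k) ÷ (suc n ∸ k +ℕ 1)) * bernTable n k)

bernoulliNumber : ℕ → ℚ
bernoulliNumber n = bernTable n n

-- Bernoulli polynomials of order r, evaluated at x, via their e.g.f.
-- (t/(e^t-1))^r e^{xt}: order 0 is e^{xt} (coefficients x^n) and multiplying
-- the e.g.f. by t/(e^t-1) is binomial convolution with (B_k).
bernoulliPolyOrder : ℕ → ℕ → ℚ → ℚ
bernoulliPolyOrder zero    n x = pow x n
bernoulliPolyOrder (suc r) n x =
  sumBelow (suc n) (λ k → ((n C k) ÷ 1) * bernoulliNumber k * bernoulliPolyOrder r (n ∸ k) x)

bernoulliPoly : ℕ → ℚ → ℚ
bernoulliPoly n x = bernoulliPolyOrder 1 n x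

{-# OPTIONS --safe #-}

-- Encode a sequence aₙ by its exponential generating function ∑ aₙ tⁿ/n!
-- and write β = t/(eᵗ − 1), so that B_n(x)/n! = [tⁿ] β e^{xt} and
-- B^(r)_k(x)/k! = [tᵏ] β^r e^{xt}. Since β · (eᵗ − 1)/t = 1,
--   β e^{xt} = (β ((eᵗ − 1)/t)^r) · (β^r e^{xt}).
-- By the binomial theorem β (eᵗ − 1)^r = ∑ⱼ C(r,j) (−1)^(r−j) β e^{jt}, whose coefficient of
-- tᵐ is Δʳ B_m(0)/m!; it has no terms below t^r, and shifting it down by r gives
-- β ((eᵗ − 1)/t)^r. Comparing coefficients of tⁿ gives
--   B_n(x) = n! ∑_{k ≤ n} Δʳ B_{n+r−k}(0) B^(r)_k(x) / ((n+r−k)! k!),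
-- and both displayed coefficients equal n!/(k! (n+r−k)!); the terms with n < k < r vanish.

module Submission where

open import Defs
open import Data.Nat as ℕ using (ℕ; zero; suc; _∸_; _!; _≤_; _<_; z≤n; s≤s)
  renaming (_+_ to _+ℕ_; _*_ to _*ℕ_)
import Data.Nat.Properties as ℕ
open import Data.Nat.Combinatorics using (_C_; nCk≡n!/k![n-k]!; k![n∸k]!∣n!)
open import Data.Nat.DivMod using (m/n*n≡m)
import Data.Integer as ℤ
import Data.Integer.Properties as ℤ
open import Data.Rational using (ℚ; 0ℚ; 1ℚ; _+_; _*_; -_; toℚᵘ)
open import Data.Rational.Properties
import Data.Rational.Unnormalised as ℚᵘ
import Data.Rational.Unnormalised.Properties as ℚᵘ
open import Data.Rational.Solver using (module +-*-Solver)
open +-*-Solver using (solve; _:+_; _:*_; _:=_; con; :-_)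
open import Data.Fin using (Fin; toℕ) renaming (zero to fzero; suc to fsuc)
import Data.Vec.Functional as Vector
open import Data.Product using (_,_)
open import Data.Sum using ([_,_]′)
open import Data.Empty using (⊥-elim)
open import Relation.Nullary using (yes; no)
open import Relation.Binary.PropositionalEquality
open import Relation.Binary.Structures using (IsEquivalence)
open import Level using (0ℓ)
open import Algebra.Bundles using (CommutativeSemiring; CommutativeRing)
import Algebra.Definitions.RawSemiring as RawSemiringDefs
import Algebra.Properties.CommutativeSemiring.Binomial as Binomial
import Algebra.Properties.CommutativeSemigroup as CommutativeSemigroupProperties

open ≡-Reasoning

ι : ℕ → ℚ
ι n = n ÷ 1

ι-toℚᵘ : ∀ n → toℚᵘ (ι n) ℚᵘ.≃ ℚᵘ.mkℚᵘ (ℤ.+ n) 0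
ι-toℚᵘ n = toℚᵘ-fromℚᵘ (ℚᵘ.mkℚᵘ (ℤ.+ n) 0)

ι-homo-+ : ∀ m n → ι (m +ℕ n) ≡ ι m + ι n
ι-homo-+ m n = toℚᵘ-injective (ℚᵘ.≃-trans (ι-toℚᵘ (m +ℕ n))
  (ℚᵘ.≃-trans unnormalised
    (ℚᵘ.≃-sym (ℚᵘ.≃-trans (toℚᵘ-homo-+ (ι m) (ι n)) (ℚᵘ.+-cong (ι-toℚᵘ m) (ι-toℚᵘ n))))))
  where
  unnormalised : ℚᵘ.mkℚᵘ (ℤ.+ (m +ℕ n)) 0 ℚᵘ.≃ (ℚᵘ.mkℚᵘ (ℤ.+ m) 0 ℚᵘ.+ ℚᵘ.mkℚᵘ (ℤ.+ n) 0)
  unnormalised = ℚᵘ.*≡* (cong (ℤ._* ℤ.+ 1) (trans (ℤ.pos-+ m n)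
    (cong₂ ℤ._+_ (sym (ℤ.*-identityʳ (ℤ.+ m))) (sym (ℤ.*-identityʳ (ℤ.+ n))))))

ι-homo-* : ∀ m n → ι (m *ℕ n) ≡ ι m * ι n
ι-homo-* m n = toℚᵘ-injective (ℚᵘ.≃-trans (ι-toℚᵘ (m *ℕ n))
  (ℚᵘ.≃-trans unnormalised
    (ℚᵘ.≃-sym (ℚᵘ.≃-trans (toℚᵘ-homo-* (ι m) (ι n)) (ℚᵘ.*-cong (ι-toℚᵘ m) (ι-toℚᵘ n))))))
  where
  unnormalised : ℚᵘ.mkℚᵘ (ℤ.+ (m *ℕ n)) 0 ℚᵘ.≃ (ℚᵘ.mkℚᵘ (ℤ.+ m) 0 ℚᵘ.* ℚᵘ.mkℚᵘ (ℤ.+ n) 0)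
  unnormalised = ℚᵘ.*≡* (cong (ℤ._* ℤ.+ 1) (ℤ.pos-* m n))

m÷n*n≡m : ∀ m d → (m ÷ suc d) * ι (suc d) ≡ ι m
m÷n*n≡m m d = toℚᵘ-injective (ℚᵘ.≃-trans (toℚᵘ-homo-* (m ÷ suc d) (ι (suc d)))
  (ℚᵘ.≃-trans (ℚᵘ.*-cong (toℚᵘ-fromℚᵘ (ℚᵘ.mkℚᵘ (ℤ.+ m) d)) (ι-toℚᵘ (suc d)))
  (ℚᵘ.≃-trans unnormalised (ℚᵘ.≃-sym (ι-toℚᵘ m)))))
  where
  unnormalised : (ℚᵘ.mkℚᵘ (ℤ.+ m) d ℚᵘ.* ℚᵘ.mkℚᵘ (ℤ.+ suc d) 0) ℚᵘ.≃ ℚᵘ.mkℚᵘ (ℤ.+ m) 0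
  unnormalised = ℚᵘ.*≡* (trans (ℤ.*-identityʳ _)
    (cong (λ z → ℤ.+ m ℤ.* ℤ.+ suc z) (sym (ℕ.*-identityʳ d))))

*ι-cancelʳ : ∀ {x y} n → n ≢ 0 → x * ι n ≡ y * ι n → x ≡ y
*ι-cancelʳ zero n≢0 _ = ⊥-elim (n≢0 refl)
*ι-cancelʳ {x} {y} (suc d) _ eq = begin
  x                                ≡⟨ sym (*-identityʳ x) ⟩
  x * 1ℚ                           ≡⟨ cong (x *_) (sym (m÷n*n≡m 1 d)) ⟩
  x * ((1 ÷ suc d) * ι (suc d))    ≡⟨ reassoc x ⟩
  (x * ι (suc d)) * (1 ÷ suc d)    ≡⟨ cong (_* (1 ÷ suc d)) eq ⟩
  (y * ι (suc d)) * (1 ÷ suc d)    ≡⟨ sym (reassoc y) ⟩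
  y * ((1 ÷ suc d) * ι (suc d))    ≡⟨ cong (y *_) (m÷n*n≡m 1 d) ⟩
  y * 1ℚ                           ≡⟨ *-identityʳ y ⟩
  y                                ∎
  where
  reassoc : ∀ z → z * ((1 ÷ suc d) * ι (suc d)) ≡ (z * ι (suc d)) * (1 ÷ suc d)
  reassoc z = solve 3 (λ a b c → a :* (b :* c) := (a :* c) :* b) refl z (1 ÷ suc d) (ι (suc d))

÷-unique : ∀ m n z → n ≢ 0 → z * ι n ≡ ι m → m ÷ n ≡ z
÷-unique m zero z n≢0 _ = ⊥-elim (n≢0 refl)
÷-unique m (suc d) z n≢0 eq = *ι-cancelʳ (suc d) n≢0 (trans (m÷n*n≡m m d) (sym eq))

n!≢0 : ∀ n → n ! ≢ 0
n!≢0 n = ℕ.≢-nonZero⁻¹ (n !) {{ℕ._!≢0 n}}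

invFact : ℕ → ℚ
invFact n = 1 ÷ (n !)

invFact*n!≡1 : ∀ n → invFact n * ι (n !) ≡ 1ℚ
invFact*n!≡1 n with n ! | n!≢0 n
... | zero  | n!≢0 = ⊥-elim (n!≢0 refl)
... | suc d | _    = m÷n*n≡m 1 d

nCk*k!*[n∸k]!≡n! : ∀ {n k} → k ≤ n → (n C k) *ℕ (k ! *ℕ (n ∸ k) !) ≡ n !
nCk*k!*[n∸k]!≡n! {n} {k} k≤n = trans (cong (_*ℕ (k ! *ℕ (n ∸ k) !)) (nCk≡n!/k![n-k]! k≤n))
  (m/n*n≡m {{ℕ._!*_!≢0 k (n ∸ k)}} (k![n∸k]!∣n! k≤n))

nCk≢0 : ∀ {n k} → k ≤ n → n C k ≢ 0
nCk≢0 {n} {k} k≤n nCk≡0 =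
  n!≢0 n (trans (sym (nCk*k!*[n∸k]!≡n! k≤n)) (cong (_*ℕ (k ! *ℕ (n ∸ k) !)) nCk≡0))

ι-nCk*k!*[n∸k]!≡n! : ∀ {n k} → k ≤ n → ι (n C k) * (ι (k !) * ι ((n ∸ k) !)) ≡ ι (n !)
ι-nCk*k!*[n∸k]!≡n! {n} {k} k≤n = begin
  ι (n C k) * (ι (k !) * ι ((n ∸ k) !)) ≡⟨ cong (ι (n C k) *_) (sym (ι-homo-* (k !) _)) ⟩
  ι (n C k) * ι (k ! *ℕ (n ∸ k) !)      ≡⟨ sym (ι-homo-* (n C k) _) ⟩
  ι ((n C k) *ℕ (k ! *ℕ (n ∸ k) !))     ≡⟨ cong ι (nCk*k!*[n∸k]!≡n! k≤n) ⟩
  ι (n !)                               ∎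

invFact*invFact≡invFact*nCk : ∀ {n k} → k ≤ n → invFact k * invFact (n ∸ k) ≡ invFact n * ι (n C k)
invFact*invFact≡invFact*nCk {n} {k} k≤n = *ι-cancelʳ (n !) (n!≢0 n) (begin
  a * b * ι (n !)                 ≡⟨ cong (a * b *_) (sym (ι-nCk*k!*[n∸k]!≡n! k≤n)) ⟩
  a * b * (c * (ι (k !) * ι ((n ∸ k) !)))
    ≡⟨ solve 5 (λ a b c u v → a :* b :* (c :* (u :* v)) := c :* ((a :* u) :* (b :* v)))
         refl a b c (ι (k !)) (ι ((n ∸ k) !)) ⟩
  c * ((a * ι (k !)) * (b * ι ((n ∸ k) !)))
    ≡⟨ cong₂ (λ u v → c * (u * v)) (invFact*n!≡1 k) (invFact*n!≡1 (n ∸ k)) ⟩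
  c * (1ℚ * 1ℚ)                   ≡⟨ cong (c *_) (sym (invFact*n!≡1 n)) ⟩
  c * (invFact n * ι (n !))       ≡⟨ solve 3 (λ c p q → c :* (p :* q) := p :* c :* q) refl c (invFact n) (ι (n !)) ⟩
  invFact n * c * ι (n !)         ∎)
  where
  a b c : ℚ
  a = invFact k
  b = invFact (n ∸ k)
  c = ι (n C k)

÷≡n!/[k!m!] : ∀ a b n k m → b ≢ 0 → ι (n !) * ι b ≡ ι a * (ι (k !) * ι (m !)) →
              a ÷ b ≡ ι (n !) * (invFact k * invFact m)
÷≡n!/[k!m!] a b n k m b≢0 eq = ÷-unique a b _ b≢0 (begin
  ι (n !) * (invFact k * invFact m) * ι b
    ≡⟨ solve 4 (λ f p q y → f :* (p :* q) :* y := p :* q :* (f :* y)) refl (ι (n !)) (invFact k) (invFact m) (ι b) ⟩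
  invFact k * invFact m * (ι (n !) * ι b)
    ≡⟨ cong (invFact k * invFact m *_) eq ⟩
  invFact k * invFact m * (ι a * (ι (k !) * ι (m !)))
    ≡⟨ solve 5 (λ p q x u v → p :* q :* (x :* (u :* v)) := x :* ((p :* u) :* (q :* v)))
         refl (invFact k) (invFact m) (ι a) (ι (k !)) (ι (m !)) ⟩
  ι a * ((invFact k * ι (k !)) * (invFact m * ι (m !)))
    ≡⟨ cong₂ (λ u v → ι a * (u * v)) (invFact*n!≡1 k) (invFact*n!≡1 m) ⟩
  ι a * (1ℚ * 1ℚ)
    ≡⟨ *-identityʳ (ι a) ⟩
  ι a ∎)

m<n⇒n∸m≡1+[n∸1+m] : ∀ {m n} → m < n → n ∸ m ≡ suc (n ∸ suc m)
m<n⇒n∸m≡1+[n∸1+m] {zero}  {suc n} _         = refl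
m<n⇒n∸m≡1+[n∸1+m] {suc m} {suc n} (s≤s m<n) = m<n⇒n∸m≡1+[n∸1+m] m<n

p+r∸[1+p+i]<r : ∀ p {r i} → i < r → p +ℕ r ∸ (suc p +ℕ i) < r
p+r∸[1+p+i]<r p {r} {i} i<r = subst (p +ℕ r ∸ (suc p +ℕ i) <_) (ℕ.m+n∸m≡n p r)
  (ℕ.∸-monoʳ-< (s≤s (ℕ.m≤m+n p i)) (subst (_≤ p +ℕ r) (ℕ.+-suc p i) (ℕ.+-monoʳ-≤ p i<r)))

i<1+b∸a⇒a+i≤b : ∀ {a b i} → i < suc b ∸ a → a +ℕ i ≤ b
i<1+b∸a⇒a+i≤b {a} {b} {i} i<1+b∸a =
  subst (_≤ b) (ℕ.+-comm i a) (ℕ.≤-pred (ℕ.m≤o∸n⇒m+n≤o (suc i) a≤1+b i<1+b∸a))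
  where
  a≤1+b : a ≤ suc b
  a≤1+b = ℕ.<⇒≤ (ℕ.m∸n≢0⇒n<m (λ 1+b∸a≡0 → ℕ.n≮0 (subst (i <_) 1+b∸a≡0 i<1+b∸a)))

sumBelow-cong : ∀ n {f g : ℕ → ℚ} → (∀ i → f i ≡ g i) → sumBelow n f ≡ sumBelow n g
sumBelow-cong zero    f≡g = refl
sumBelow-cong (suc n) f≡g = cong₂ _+_ (sumBelow-cong n f≡g) (f≡g n)

sumBelow-cong-< : ∀ n {f g : ℕ → ℚ} → (∀ i → i < n → f i ≡ g i) → sumBelow n f ≡ sumBelow n g
sumBelow-cong-< zero    f≡g = refl
sumBelow-cong-< (suc n) f≡g =
  cong₂ _+_ (sumBelow-cong-< n (λ i i<n → f≡g i (ℕ.m<n⇒m<1+n i<n))) (f≡g n ℕ.≤-refl)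

sumBelow-≡0 : ∀ n {f : ℕ → ℚ} → (∀ i → i < n → f i ≡ 0ℚ) → sumBelow n f ≡ 0ℚ
sumBelow-≡0 zero    f≡0 = refl
sumBelow-≡0 (suc n) f≡0 = cong₂ _+_ (sumBelow-≡0 n (λ i i<n → f≡0 i (ℕ.m<n⇒m<1+n i<n))) (f≡0 n ℕ.≤-refl)

sumBelow-+ : ∀ n (f g : ℕ → ℚ) → sumBelow n (λ i → f i + g i) ≡ sumBelow n f + sumBelow n g
sumBelow-+ zero    f g = refl
sumBelow-+ (suc n) f g = trans (cong (_+ (f n + g n)) (sumBelow-+ n f g))
  (solve 4 (λ a b c d → (a :+ b) :+ (c :+ d) := (a :+ c) :+ (b :+ d)) refl
     (sumBelow n f) (sumBelow n g) (f n) (g n))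

*-distribˡ-sumBelow : ∀ n c (f : ℕ → ℚ) → c * sumBelow n f ≡ sumBelow n (λ i → c * f i)
*-distribˡ-sumBelow zero    c f = *-zeroʳ c
*-distribˡ-sumBelow (suc n) c f =
  trans (*-distribˡ-+ c (sumBelow n f) (f n)) (cong (_+ c * f n) (*-distribˡ-sumBelow n c f))

*-distribʳ-sumBelow : ∀ n c (f : ℕ → ℚ) → sumBelow n f * c ≡ sumBelow n (λ i → f i * c)
*-distribʳ-sumBelow n c f = trans (*-comm (sumBelow n f) c)
  (trans (*-distribˡ-sumBelow n c f) (sumBelow-cong n (λ i → *-comm c (f i))))

sumBelow-sucˡ : ∀ n (f : ℕ → ℚ) → sumBelow (suc n) f ≡ f 0 + sumBelow n (λ i → f (suc i))
sumBelow-sucˡ zero    f = trans (+-identityˡ (f 0)) (sym (+-identityʳ (f 0)))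
sumBelow-sucˡ (suc n) f = trans (cong (_+ f (suc n)) (sumBelow-sucˡ n f)) (+-assoc (f 0) _ _)

sumBelow-split : ∀ m n (f : ℕ → ℚ) → sumBelow (m +ℕ n) f ≡ sumBelow m f + sumBelow n (λ i → f (m +ℕ i))
sumBelow-split m zero    f = trans (cong (λ l → sumBelow l f) (ℕ.+-identityʳ m)) (sym (+-identityʳ _))
sumBelow-split m (suc n) f = begin
  sumBelow (m +ℕ suc n) f                                    ≡⟨ cong (λ l → sumBelow l f) (ℕ.+-suc m n) ⟩
  sumBelow (m +ℕ n) f + f (m +ℕ n)                           ≡⟨ cong (_+ f (m +ℕ n)) (sumBelow-split m n f) ⟩
  sumBelow m f + sumBelow n (λ i → f (m +ℕ i)) + f (m +ℕ n)  ≡⟨ +-assoc (sumBelow m f) _ _ ⟩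
  sumBelow m f + sumBelow (suc n) (λ i → f (m +ℕ i))         ∎

sumBelow-comm : ∀ m n (f : ℕ → ℕ → ℚ) →
  sumBelow m (λ i → sumBelow n (f i)) ≡ sumBelow n (λ j → sumBelow m (λ i → f i j))
sumBelow-comm zero    n f = sym (sumBelow-≡0 n (λ _ _ → refl))
sumBelow-comm (suc m) n f = begin
  sumBelow m (λ i → sumBelow n (f i)) + sumBelow n (f m)
    ≡⟨ cong (_+ sumBelow n (f m)) (sumBelow-comm m n f) ⟩
  sumBelow n (λ j → sumBelow m (λ i → f i j)) + sumBelow n (f m)
    ≡⟨ sym (sumBelow-+ n _ _) ⟩
  sumBelow n (λ j → sumBelow (suc m) (λ i → f i j)) ∎

sumBelow-reverse : ∀ n (f : ℕ → ℚ) → sumBelow n f ≡ sumBelow n (λ i → f (n ∸ suc i))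
sumBelow-reverse zero    f = refl
sumBelow-reverse (suc n) f = begin
  sumBelow n f + f n                      ≡⟨ +-comm (sumBelow n f) (f n) ⟩
  f n + sumBelow n f                      ≡⟨ cong (f n +_) (sumBelow-reverse n f) ⟩
  f n + sumBelow n (λ i → f (n ∸ suc i))  ≡⟨ sym (sumBelow-sucˡ n (λ i → f (n ∸ i))) ⟩
  sumBelow (suc n) (λ i → f (n ∸ i))      ∎

sumBelow-triangle : ∀ n (f : ℕ → ℕ → ℚ) →
  sumBelow (suc n) (λ k → sumBelow (suc k) (λ i → f i k))
    ≡ sumBelow (suc n) (λ i → sumBelow (suc (n ∸ i)) (λ j → f i (i +ℕ j)))
sumBelow-triangle zero    f = refl
sumBelow-triangle (suc n) f = begin
  sumBelow (suc n) (λ k → sumBelow (suc k) (λ i → f i k)) + (column + f (suc n) (suc n))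
    ≡⟨ cong (_+ (column + f (suc n) (suc n))) (sumBelow-triangle n f) ⟩
  rows n + (column + f (suc n) (suc n))
    ≡⟨ sym (+-assoc (rows n) column _) ⟩
  rows n + column + f (suc n) (suc n)
    ≡⟨ cong₂ _+_ (sym (sumBelow-+ (suc n) _ _)) (sym (+-identityˡ _)) ⟩
  sumBelow (suc n) (λ i → row n i + f i (suc n)) + (0ℚ + f (suc n) (suc n))
    ≡⟨ cong₂ _+_ (sumBelow-cong-< (suc n) extend-row)
                 (cong (λ l → 0ℚ + f (suc n) l) (sym (ℕ.+-identityʳ (suc n)))) ⟩
  sumBelow (suc n) (row (suc n)) + sumBelow 1 (λ j → f (suc n) (suc n +ℕ j))
    ≡⟨ cong (λ l → sumBelow (suc n) (row (suc n)) + sumBelow (suc l) (λ j → f (suc n) (suc n +ℕ j)))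
            (sym (ℕ.n∸n≡0 n)) ⟩
  rows (suc n) ∎
  where
  row : ℕ → ℕ → ℚ
  row m i = sumBelow (suc (m ∸ i)) (λ j → f i (i +ℕ j))
  rows : ℕ → ℚ
  rows m = sumBelow (suc m) (row m)
  column : ℚ
  column = sumBelow (suc n) (λ i → f i (suc n))
  extend-row : ∀ i → i < suc n → row n i + f i (suc n) ≡ row (suc n) i
  extend-row i (s≤s i≤n) = begin
    row n i + f i (suc n)
      ≡⟨ cong (λ l → row n i + f i l) (sym (trans (ℕ.+-suc i (n ∸ i)) (cong suc (ℕ.m+[n∸m]≡n i≤n)))) ⟩
    sumBelow (suc (suc (n ∸ i))) (λ j → f i (i +ℕ j))
      ≡⟨ cong (λ l → sumBelow (suc l) (λ j → f i (i +ℕ j))) (sym (ℕ.+-∸-assoc 1 i≤n)) ⟩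
    row (suc n) i ∎

sumFromTo-cong : ∀ a b {f g : ℕ → ℚ} → (∀ k → a ≤ k → k ≤ b → f k ≡ g k) → sumFromTo a b f ≡ sumFromTo a b g
sumFromTo-cong a b f≡g = sumBelow-cong-< (suc b ∸ a) (λ i i< → f≡g (a +ℕ i) (ℕ.m≤m+n a i) (i<1+b∸a⇒a+i≤b i<))

sumBelow+sumFromTo : ∀ r n (f : ℕ → ℚ) → (∀ k → n < k → k < r → f k ≡ 0ℚ) →
                     sumBelow r f + sumFromTo r n f ≡ sumBelow (suc n) f
sumBelow+sumFromTo r n f f-gap with r ℕ.≤? suc n
... | yes r≤1+n = trans (sym (sumBelow-split r (suc n ∸ r) f)) (cong (λ l → sumBelow l f) (ℕ.m+[n∸m]≡n r≤1+n))
... | no  r≰1+n = begin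
  sumBelow r f + sumBelow (suc n ∸ r) (λ i → f (r +ℕ i))
    ≡⟨ cong₂ (λ l m → sumBelow l f + sumBelow m (λ i → f (r +ℕ i)))
             (sym (ℕ.m+[n∸m]≡n 1+n≤r)) (ℕ.m≤n⇒m∸n≡0 1+n≤r) ⟩
  sumBelow (suc n +ℕ (r ∸ suc n)) f + 0ℚ
    ≡⟨ +-identityʳ _ ⟩
  sumBelow (suc n +ℕ (r ∸ suc n)) f
    ≡⟨ sumBelow-split (suc n) (r ∸ suc n) f ⟩
  sumBelow (suc n) f + sumBelow (r ∸ suc n) (λ i → f (suc n +ℕ i))
    ≡⟨ cong (sumBelow (suc n) f +_) (sumBelow-≡0 (r ∸ suc n) gap) ⟩
  sumBelow (suc n) f + 0ℚ
    ≡⟨ +-identityʳ _ ⟩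
  sumBelow (suc n) f ∎
  where
  1+n≤r : suc n ≤ r
  1+n≤r = ℕ.<⇒≤ (ℕ.≰⇒> r≰1+n)
  gap : ∀ i → i < r ∸ suc n → f (suc n +ℕ i) ≡ 0ℚ
  gap i i<r∸[1+n] = f-gap (suc n +ℕ i) (s≤s (ℕ.m≤m+n n i))
    (subst (suc n +ℕ i <_) (ℕ.m+[n∸m]≡n 1+n≤r) (ℕ.+-monoʳ-< (suc n) i<r∸[1+n]))

-- Formal power series over ℚ

Series : Set
Series = ℕ → ℚ

infix 4 _≈ₛ_
_≈ₛ_ : Series → Series → Set
f ≈ₛ g = ∀ n → f n ≡ g n

infixl 6 _+ₛ_
_+ₛ_ : Series → Series → Series
(f +ₛ g) n = f n + g n

infixl 7 _⋆_
_⋆_ : Series → Series → Series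
(f ⋆ g) n = sumBelow (suc n) (λ k → f k * g (n ∸ k))

0ₛ : Series
0ₛ _ = 0ℚ

1ₛ : Series
1ₛ zero    = 1ℚ
1ₛ (suc _) = 0ℚ

≈ₛ-isEquivalence : IsEquivalence _≈ₛ_
≈ₛ-isEquivalence = record
  { refl  = λ _ → refl
  ; sym   = λ f≈g n → sym (f≈g n)
  ; trans = λ f≈g g≈h n → trans (f≈g n) (g≈h n)
  }

open IsEquivalence ≈ₛ-isEquivalence using () renaming (refl to ≈ₛ-refl; trans to ≈ₛ-trans)

⋆-cong : ∀ {f f′ g g′} → f ≈ₛ f′ → g ≈ₛ g′ → f ⋆ g ≈ₛ f′ ⋆ g′
⋆-cong f≈f′ g≈g′ n = sumBelow-cong (suc n) (λ k → cong₂ _*_ (f≈f′ k) (g≈g′ (n ∸ k)))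

⋆-congˡ : ∀ f {g g′} → g ≈ₛ g′ → f ⋆ g ≈ₛ f ⋆ g′
⋆-congˡ f = ⋆-cong {f} {f} ≈ₛ-refl

⋆-comm : ∀ f g → f ⋆ g ≈ₛ g ⋆ f
⋆-comm f g n = trans (sumBelow-reverse (suc n) _) (sumBelow-cong-< (suc n) swap)
  where
  swap : ∀ i → i < suc n → f (n ∸ i) * g (n ∸ (n ∸ i)) ≡ g i * f (n ∸ i)
  swap i (s≤s i≤n) = trans (cong (λ j → f (n ∸ i) * g j) (ℕ.m∸[m∸n]≡n i≤n)) (*-comm (f (n ∸ i)) (g i))

⋆-assoc : ∀ f g h → (f ⋆ g) ⋆ h ≈ₛ f ⋆ (g ⋆ h)
⋆-assoc f g h n = begin
  sumBelow (suc n) (λ k → sumBelow (suc k) (λ i → f i * g (k ∸ i)) * h (n ∸ k))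
    ≡⟨ sumBelow-cong (suc n) (λ k → *-distribʳ-sumBelow (suc k) (h (n ∸ k)) _) ⟩
  sumBelow (suc n) (λ k → sumBelow (suc k) (λ i → f i * g (k ∸ i) * h (n ∸ k)))
    ≡⟨ sumBelow-triangle n (λ i k → f i * g (k ∸ i) * h (n ∸ k)) ⟩
  sumBelow (suc n) (λ i → sumBelow (suc (n ∸ i)) (λ j → f i * g (i +ℕ j ∸ i) * h (n ∸ (i +ℕ j))))
    ≡⟨ sumBelow-cong (suc n) (λ i → trans (sumBelow-cong (suc (n ∸ i)) (reindex i))
                                          (sym (*-distribˡ-sumBelow (suc (n ∸ i)) (f i) _))) ⟩
  sumBelow (suc n) (λ i → f i * sumBelow (suc (n ∸ i)) (λ j → g j * h (n ∸ i ∸ j))) ∎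
  where
  reindex : ∀ i j → f i * g (i +ℕ j ∸ i) * h (n ∸ (i +ℕ j)) ≡ f i * (g j * h (n ∸ i ∸ j))
  reindex i j = trans (cong₂ (λ a b → f i * g a * h b) (ℕ.m+n∸m≡n i j) (sym (ℕ.∸-+-assoc n i j)))
                      (*-assoc (f i) _ _)

⋆-distribˡ-+ₛ : ∀ f g h → f ⋆ (g +ₛ h) ≈ₛ f ⋆ g +ₛ f ⋆ h
⋆-distribˡ-+ₛ f g h n =
  trans (sumBelow-cong (suc n) (λ k → *-distribˡ-+ (f k) _ _)) (sumBelow-+ (suc n) _ _)

⋆-zeroʳ : ∀ f → f ⋆ 0ₛ ≈ₛ 0ₛ
⋆-zeroʳ f n = sumBelow-≡0 (suc n) (λ i _ → *-zeroʳ (f i))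

⋆-identityʳ : ∀ f → f ⋆ 1ₛ ≈ₛ f
⋆-identityʳ f n = begin
  sumBelow n (λ k → f k * 1ₛ (n ∸ k)) + f n * 1ₛ (n ∸ n)
    ≡⟨ cong₂ _+_ (sumBelow-≡0 n below-n) (cong (λ j → f n * 1ₛ j) (ℕ.n∸n≡0 n)) ⟩
  0ℚ + f n * 1ℚ
    ≡⟨ trans (+-identityˡ _) (*-identityʳ (f n)) ⟩
  f n ∎
  where
  below-n : ∀ i → i < n → f i * 1ₛ (n ∸ i) ≡ 0ℚ
  below-n i i<n = trans (cong (λ j → f i * 1ₛ j) (m<n⇒n∸m≡1+[n∸1+m] i<n)) (*-zeroʳ (f i))

⋆-identityˡ : ∀ f → 1ₛ ⋆ f ≈ₛ f
⋆-identityˡ f = ≈ₛ-trans (⋆-comm 1ₛ f) (⋆-identityʳ f)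

⋆-scalarʳ : ∀ c f g → f ⋆ (λ n → c * g n) ≈ₛ (λ n → c * (f ⋆ g) n)
⋆-scalarʳ c f g n = trans
  (sumBelow-cong (suc n) (λ k → solve 3 (λ x c y → x :* (c :* y) := c :* (x :* y)) refl (f k) c (g (n ∸ k))))
  (sym (*-distribˡ-sumBelow (suc n) c _))

seriesSemiring : CommutativeSemiring 0ℓ 0ℓ
seriesSemiring = record
  { Carrier = Series ; _≈_ = _≈ₛ_ ; _+_ = _+ₛ_ ; _*_ = _⋆_ ; 0# = 0ₛ ; 1# = 1ₛ
  ; isCommutativeSemiring = isCommutativeSemiringʳ record
    { +-isCommutativeMonoid = record
      { isMonoid = record
        { isSemigroup = record
          { isMagma = record
            { isEquivalence = ≈ₛ-isEquivalence ; ∙-cong = λ f≈f′ g≈g′ n → cong₂ _+_ (f≈f′ n) (g≈g′ n) }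
          ; assoc = λ f g h n → +-assoc (f n) (g n) (h n) }
        ; identity = (λ f n → +-identityˡ (f n)) , (λ f n → +-identityʳ (f n)) }
      ; comm = λ f g n → +-comm (f n) (g n) }
    ; *-isCommutativeMonoid = record
      { isMonoid = record
        { isSemigroup = record
          { isMagma = record { isEquivalence = ≈ₛ-isEquivalence ; ∙-cong = ⋆-cong }
          ; assoc = ⋆-assoc }
        ; identity = ⋆-identityˡ , ⋆-identityʳ }
      ; comm = ⋆-comm }
    ; distribˡ = ⋆-distribˡ-+ₛ
    ; zeroʳ = ⋆-zeroʳ
    }
  }
  where open import Algebra.Structures.Biased (_≈ₛ_) using (isCommutativeSemiringʳ)

ℚ-semiring : CommutativeSemiring 0ℓ 0ℓ
ℚ-semiring = CommutativeRing.commutativeSemiring +-*-commutativeRing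

module ℚ-Binomial = Binomial ℚ-semiring
module ℚ-Raw = RawSemiringDefs (CommutativeSemiring.rawSemiring ℚ-semiring)
module Series-Binomial = Binomial seriesSemiring
open RawSemiringDefs (CommutativeSemiring.rawSemiring seriesSemiring) using ()
  renaming (_^_ to _^ₛ_; _×_ to _×ₛ_)

foldr-+≡sumBelow : ∀ k (F : Fin k → ℚ) (f : ℕ → ℚ) → (∀ i → F i ≡ f (toℕ i)) →
                   Vector.foldr _+_ 0ℚ F ≡ sumBelow k f
foldr-+≡sumBelow zero    F f F≡f = refl
foldr-+≡sumBelow (suc k) F f F≡f = trans
  (cong₂ _+_ (F≡f fzero) (foldr-+≡sumBelow k (λ i → F (fsuc i)) (λ i → f (suc i)) (λ i → F≡f (fsuc i))))
  (sym (sumBelow-sucˡ k f))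

foldr-+ₛ≡sumBelow : ∀ k (F : Fin k → Series) (f : ℕ → ℚ) p → (∀ i → F i p ≡ f (toℕ i)) →
                    Vector.foldr _+ₛ_ 0ₛ F p ≡ sumBelow k f
foldr-+ₛ≡sumBelow zero    F f p F≡f = refl
foldr-+ₛ≡sumBelow (suc k) F f p F≡f = trans
  (cong₂ _+_ (F≡f fzero) (foldr-+ₛ≡sumBelow k (λ i → F (fsuc i)) (λ i → f (suc i)) p (λ i → F≡f (fsuc i))))
  (sym (sumBelow-sucˡ k f))

x+ι[m]*x≡ι[1+m]*x : ∀ m x → x + ι m * x ≡ ι (suc m) * x
x+ι[m]*x≡ι[1+m]*x m x = begin
  x + ι m * x     ≡⟨ solve 2 (λ a b → a :+ b :* a := (con 1ℚ :+ b) :* a) refl x (ι m) ⟩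
  (1ℚ + ι m) * x  ≡⟨ cong (_* x) (sym (ι-homo-+ 1 m)) ⟩
  ι (suc m) * x   ∎

×≡ι* : ∀ m x → m ℚ-Raw.× x ≡ ι m * x
×≡ι* zero    x = sym (*-zeroˡ x)
×≡ι* (suc m) x = trans (cong (x +_) (×≡ι* m x)) (x+ι[m]*x≡ι[1+m]*x m x)

×ₛ≡ι* : ∀ m f p → (m ×ₛ f) p ≡ ι m * f p
×ₛ≡ι* zero    f p = sym (*-zeroˡ (f p))
×ₛ≡ι* (suc m) f p = trans (cong (f p +_) (×ₛ≡ι* m f p)) (x+ι[m]*x≡ι[1+m]*x m (f p))

^≡pow : ∀ x n → x ℚ-Raw.^ n ≡ pow x n
^≡pow x zero    = refl
^≡pow x (suc n) = cong (x *_) (^≡pow x n)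

^ₛ-cong : ∀ r {f g} → f ≈ₛ g → f ^ₛ r ≈ₛ g ^ₛ r
^ₛ-cong zero    f≈g = ≈ₛ-refl
^ₛ-cong (suc r) f≈g = ⋆-cong f≈g (^ₛ-cong r f≈g)

pow-binomial : ∀ n a b → pow (a + b) n ≡ sumBelow (suc n) (λ k → ι (n C k) * (pow a k * pow b (n ∸ k)))
pow-binomial n a b = begin
  pow (a + b) n                     ≡⟨ sym (^≡pow (a + b) n) ⟩
  (a + b) ℚ-Raw.^ n                 ≡⟨ ℚ-Binomial.theorem n a b ⟩
  ℚ-Binomial.binomialExpansion a b n
    ≡⟨ foldr-+≡sumBelow (suc n) _ _ (λ i → trans (×≡ι* (n C toℕ i) _)
         (cong (ι (n C toℕ i) *_) (cong₂ _*_ (^≡pow a (toℕ i)) (^≡pow b (n ∸ toℕ i))))) ⟩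
  sumBelow (suc n) (λ k → ι (n C k) * (pow a k * pow b (n ∸ k))) ∎

-- Exponential generating functions

egf : (ℕ → ℚ) → Series
egf a n = a n * invFact n

egf-binomialConvolution : ∀ (a b : ℕ → ℚ) n →
  invFact n * sumBelow (suc n) (λ k → ι (n C k) * a k * b (n ∸ k)) ≡ (egf a ⋆ egf b) n
egf-binomialConvolution a b n =
  trans (*-distribˡ-sumBelow (suc n) (invFact n) _) (sumBelow-cong-< (suc n) term)
  where
  term : ∀ k → k < suc n → invFact n * (ι (n C k) * a k * b (n ∸ k)) ≡ egf a k * egf b (n ∸ k)
  term k (s≤s k≤n) = begin
    invFact n * (ι (n C k) * a k * b (n ∸ k))
      ≡⟨ solve 4 (λ p c x y → p :* (c :* x :* y) := (p :* c) :* (x :* y)) refl (invFact n) (ι (n C k)) (a k) (b (n ∸ k)) ⟩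
    (invFact n * ι (n C k)) * (a k * b (n ∸ k))
      ≡⟨ cong (_* (a k * b (n ∸ k))) (sym (invFact*invFact≡invFact*nCk k≤n)) ⟩
    (invFact k * invFact (n ∸ k)) * (a k * b (n ∸ k))
      ≡⟨ solve 4 (λ p q x y → (p :* q) :* (x :* y) := (x :* p) :* (y :* q))
           refl (invFact k) (invFact (n ∸ k)) (a k) (b (n ∸ k)) ⟩
    egf a k * egf b (n ∸ k) ∎

exp : ℚ → Series
exp y = egf (pow y)

exp-+ : ∀ a b → exp a ⋆ exp b ≈ₛ exp (a + b)
exp-+ a b n = begin
  (exp a ⋆ exp b) n
    ≡⟨ sym (egf-binomialConvolution (pow a) (pow b) n) ⟩
  invFact n * sumBelow (suc n) (λ k → ι (n C k) * pow a k * pow b (n ∸ k))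
    ≡⟨ cong (invFact n *_) (trans (sumBelow-cong (suc n) (λ k → *-assoc (ι (n C k)) _ _)) (sym (pow-binomial n a b))) ⟩
  invFact n * pow (a + b) n
    ≡⟨ *-comm (invFact n) _ ⟩
  exp (a + b) n ∎

pow-1 : ∀ n → pow 1ℚ n ≡ 1ℚ
pow-1 zero    = refl
pow-1 (suc n) = trans (cong (1ℚ *_) (pow-1 n)) (*-identityˡ 1ℚ)

exp-ι^ : ∀ j → exp 1ℚ ^ₛ j ≈ₛ exp (ι j)
exp-ι^ zero    zero    = refl
exp-ι^ zero    (suc p) = sym (trans (cong (_* invFact (suc p)) (*-zeroˡ (pow 0ℚ p))) (*-zeroˡ (invFact (suc p))))
exp-ι^ (suc j) p       = trans (⋆-congˡ (exp 1ℚ) (exp-ι^ j) p)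
  (trans (exp-+ 1ℚ (ι j) p) (cong (λ y → exp y p) (sym (ι-homo-+ 1 j))))

-- The series eᵗ − 1 and (eᵗ − 1)/t

expm1 : Series
expm1 zero    = 0ℚ
expm1 (suc p) = invFact (suc p)

expm1/t : Series
expm1/t p = invFact (suc p)

-1ₛ : Series
-1ₛ p = - 1ₛ p

exp1+-1≈expm1 : exp 1ℚ +ₛ -1ₛ ≈ₛ expm1
exp1+-1≈expm1 zero    = refl
exp1+-1≈expm1 (suc q) =
  trans (cong (λ z → z * invFact (suc q) + 0ℚ) (pow-1 (suc q))) (trans (+-identityʳ _) (*-identityˡ _))

-1^ : ∀ m → -1ₛ ^ₛ m ≈ₛ (λ p → sign m * 1ₛ p)
-1^ zero    p = sym (*-identityˡ (1ₛ p))
-1^ (suc m) p = begin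
  (-1ₛ ⋆ -1ₛ ^ₛ m) p                  ≡⟨ ⋆-congˡ -1ₛ (-1^ m) p ⟩
  (-1ₛ ⋆ (λ p → sign m * 1ₛ p)) p     ≡⟨ ⋆-scalarʳ (sign m) -1ₛ 1ₛ p ⟩
  sign m * (-1ₛ ⋆ 1ₛ) p               ≡⟨ cong (sign m *_) (⋆-identityʳ -1ₛ p) ⟩
  sign m * (- 1ₛ p)                   ≡⟨ solve 2 (λ s d → s :* (:- d) := ((:- con 1ℚ) :* s) :* d) refl (sign m) (1ₛ p) ⟩
  sign (suc m) * 1ₛ p                 ∎

expm1^-binomial : ∀ r p →
  (expm1 ^ₛ r) p ≡ sumBelow (suc r) (λ j → ι (r C j) * (sign (r ∸ j) * exp (ι j) p))
expm1^-binomial r p = begin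
  (expm1 ^ₛ r) p                          ≡⟨ sym (^ₛ-cong r exp1+-1≈expm1 p) ⟩
  ((exp 1ℚ +ₛ -1ₛ) ^ₛ r) p                ≡⟨ Series-Binomial.theorem r (exp 1ℚ) -1ₛ p ⟩
  Series-Binomial.binomialExpansion (exp 1ℚ) -1ₛ r p
    ≡⟨ foldr-+ₛ≡sumBelow (suc r) (Series-Binomial.binomialTerm (exp 1ℚ) -1ₛ r) _ p (λ i →
         trans (×ₛ≡ι* (r C toℕ i) (exp 1ℚ ^ₛ toℕ i ⋆ -1ₛ ^ₛ (r ∸ toℕ i)) p)
               (cong (ι (r C toℕ i) *_) (term (toℕ i) (r ∸ toℕ i)))) ⟩
  sumBelow (suc r) (λ j → ι (r C j) * (sign (r ∸ j) * exp (ι j) p)) ∎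
  where
  term : ∀ j m → (exp 1ℚ ^ₛ j ⋆ -1ₛ ^ₛ m) p ≡ sign m * exp (ι j) p
  term j m = trans (⋆-cong (exp-ι^ j) (-1^ m) p)
    (trans (⋆-scalarʳ (sign m) (exp (ι j)) 1ₛ p) (cong (sign m *_) (⋆-identityʳ (exp (ι j)) p)))

expm1⋆-zero : ∀ g → (expm1 ⋆ g) 0 ≡ 0ℚ
expm1⋆-zero g = trans (+-identityˡ _) (*-zeroˡ (g 0))

expm1⋆-suc : ∀ g q → (expm1 ⋆ g) (suc q) ≡ (expm1/t ⋆ g) q
expm1⋆-suc g q = trans (sumBelow-sucˡ (suc q) _)
  (trans (cong (_+ (expm1/t ⋆ g) q) (*-zeroˡ (g (suc q)))) (+-identityˡ _))

⋆-below : ∀ f g {r q} → (∀ i → i < r → g i ≡ 0ℚ) → q < r → (f ⋆ g) q ≡ 0ℚ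
⋆-below f g {r} {q} g-below q<r = sumBelow-≡0 (suc q) (λ k _ →
  trans (cong (f k *_) (g-below (q ∸ k) (ℕ.≤-<-trans (ℕ.m∸n≤m q k) q<r))) (*-zeroʳ (f k)))

expm1^-below : ∀ r q → q < r → (expm1 ^ₛ r) q ≡ 0ℚ
expm1^-below (suc r) zero    _         = expm1⋆-zero (expm1 ^ₛ r)
expm1^-below (suc r) (suc q) (s≤s q<r) =
  trans (expm1⋆-suc (expm1 ^ₛ r) q) (⋆-below expm1/t (expm1 ^ₛ r) (expm1^-below r) q<r)

⋆-shift : ∀ f g r p → (∀ i → i < r → g i ≡ 0ℚ) → (f ⋆ g) (p +ℕ r) ≡ (f ⋆ (λ i → g (i +ℕ r))) p
⋆-shift f g r p g-below = begin
  sumBelow (suc p +ℕ r) (λ k → f k * g (p +ℕ r ∸ k))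
    ≡⟨ sumBelow-split (suc p) r _ ⟩
  sumBelow (suc p) (λ k → f k * g (p +ℕ r ∸ k)) + sumBelow r (λ i → f (suc p +ℕ i) * g (p +ℕ r ∸ (suc p +ℕ i)))
    ≡⟨ cong₂ _+_ (sumBelow-cong-< (suc p) low) (sumBelow-≡0 r high) ⟩
  (f ⋆ (λ i → g (i +ℕ r))) p + 0ℚ
    ≡⟨ +-identityʳ _ ⟩
  (f ⋆ (λ i → g (i +ℕ r))) p ∎
  where
  low : ∀ k → k < suc p → f k * g (p +ℕ r ∸ k) ≡ f k * g (p ∸ k +ℕ r)
  low k (s≤s k≤p) = cong (λ i → f k * g i) (ℕ.+-∸-comm r k≤p)
  high : ∀ i → i < r → f (suc p +ℕ i) * g (p +ℕ r ∸ (suc p +ℕ i)) ≡ 0ℚ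
  high i i<r = trans (cong (f (suc p +ℕ i) *_) (g-below _ (p+r∸[1+p+i]<r p i<r))) (*-zeroʳ (f (suc p +ℕ i)))

expm1^-shift : ∀ r p → (expm1 ^ₛ r) (p +ℕ r) ≡ (expm1/t ^ₛ r) p
expm1^-shift zero    p = cong 1ₛ (ℕ.+-identityʳ p)
expm1^-shift (suc r) p = begin
  (expm1 ^ₛ suc r) (p +ℕ suc r)                   ≡⟨ cong (expm1 ^ₛ suc r) (ℕ.+-suc p r) ⟩
  (expm1 ⋆ expm1 ^ₛ r) (suc (p +ℕ r))             ≡⟨ expm1⋆-suc (expm1 ^ₛ r) (p +ℕ r) ⟩
  (expm1/t ⋆ expm1 ^ₛ r) (p +ℕ r)                 ≡⟨ ⋆-shift expm1/t (expm1 ^ₛ r) r p (expm1^-below r) ⟩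
  (expm1/t ⋆ (λ i → (expm1 ^ₛ r) (i +ℕ r))) p     ≡⟨ ⋆-congˡ expm1/t (expm1^-shift r) p ⟩
  (expm1/t ⋆ expm1/t ^ₛ r) p                      ∎

-- Bernoulli numbers and polynomials as series

bernTable-suc : ∀ n → bernTable (suc n) (suc n) ≡
  - sumBelow (suc n) (λ k → ((suc n C k) ÷ (suc n ∸ k +ℕ 1)) * bernTable n k)
bernTable-suc n with suc n ℕ.≤? n
... | yes 1+n≤n = ⊥-elim (ℕ.<-irrefl refl 1+n≤n)
... | no  _     = refl

bernTable-stable : ∀ n m → m ≤ n → bernTable n m ≡ bernoulliNumber m
bernTable-stable zero    .zero z≤n = refl
bernTable-stable (suc n) m m≤1+n with m ℕ.≤? n
... | yes m≤n = bernTable-stable n m m≤n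
... | no  m≰n = trans (sym (bernTable-suc n))
  (cong (λ l → bernTable l l) (sym (ℕ.≤-antisym m≤1+n (ℕ.≰⇒> m≰n))))

bernoulliNumber-suc : ∀ n → bernoulliNumber (suc n) ≡
  - sumBelow (suc n) (λ k → ((suc n C k) ÷ (suc n ∸ k +ℕ 1)) * bernoulliNumber k)
bernoulliNumber-suc n = trans (bernTable-suc n) (cong -_ (sumBelow-cong-< (suc n) (λ k k<1+n →
  cong (((suc n C k) ÷ (suc n ∸ k +ℕ 1)) *_) (bernTable-stable n k (ℕ.≤-pred k<1+n)))))

invFact-suc : ∀ n → invFact (suc n) * ι (suc n) ≡ invFact n
invFact-suc n = *ι-cancelʳ (n !) (n!≢0 n) (begin
  invFact (suc n) * ι (suc n) * ι (n !)    ≡⟨ *-assoc (invFact (suc n)) _ _ ⟩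
  invFact (suc n) * (ι (suc n) * ι (n !))  ≡⟨ cong (invFact (suc n) *_) (sym (ι-homo-* (suc n) (n !))) ⟩
  invFact (suc n) * ι (suc n !)            ≡⟨ invFact*n!≡1 (suc n) ⟩
  1ℚ                                       ≡⟨ sym (invFact*n!≡1 n) ⟩
  invFact n * ι (n !)                      ∎)

invFact*invFact[1+]≡invFact*nCk/[1+] : ∀ n k → k ≤ n →
  invFact k * invFact (suc (n ∸ k)) ≡ invFact n * ((n C k) ÷ (n ∸ k +ℕ 1))
invFact*invFact[1+]≡invFact*nCk/[1+] n k k≤n = subst
  (λ l → invFact k * invFact (suc (n ∸ k)) ≡ invFact n * ((n C k) ÷ l)) (ℕ.+-comm 1 (n ∸ k))
  (*ι-cancelʳ (suc (n ∸ k)) (λ ()) (begin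
    invFact k * invFact (suc (n ∸ k)) * ι (suc (n ∸ k))      ≡⟨ *-assoc (invFact k) _ _ ⟩
    invFact k * (invFact (suc (n ∸ k)) * ι (suc (n ∸ k)))    ≡⟨ cong (invFact k *_) (invFact-suc (n ∸ k)) ⟩
    invFact k * invFact (n ∸ k)                              ≡⟨ invFact*invFact≡invFact*nCk k≤n ⟩
    invFact n * ι (n C k)                                    ≡⟨ cong (invFact n *_) (sym (m÷n*n≡m (n C k) (n ∸ k))) ⟩
    invFact n * (((n C k) ÷ suc (n ∸ k)) * ι (suc (n ∸ k)))  ≡⟨ sym (*-assoc (invFact n) _ _) ⟩
    invFact n * ((n C k) ÷ suc (n ∸ k)) * ι (suc (n ∸ k))    ∎))

bernoulliSeries : Series
bernoulliSeries = egf bernoulliNumber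

bernoulliSeries⋆expm1/t≈1 : bernoulliSeries ⋆ expm1/t ≈ₛ 1ₛ
bernoulliSeries⋆expm1/t≈1 zero    = refl
bernoulliSeries⋆expm1/t≈1 (suc n) = begin
  sumBelow (suc n) (λ k → bernoulliSeries k * expm1/t (suc n ∸ k)) + bernoulliSeries (suc n) * expm1/t (n ∸ n)
    ≡⟨ cong₂ _+_ (sumBelow-cong-< (suc n) term) (cong (λ l → bernoulliSeries (suc n) * expm1/t l) (ℕ.n∸n≡0 n)) ⟩
  sumBelow (suc n) (λ k → invFact (suc n) * (c k * bernoulliNumber k)) + bernoulliSeries (suc n) * 1ℚ
    ≡⟨ cong (_+ bernoulliSeries (suc n) * 1ℚ) (sym (*-distribˡ-sumBelow (suc n) (invFact (suc n)) _)) ⟩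
  invFact (suc n) * recurrence + bernoulliNumber (suc n) * invFact (suc n) * 1ℚ
    ≡⟨ solve 3 (λ p s b → p :* s :+ b :* p :* con 1ℚ := p :* (s :+ b)) refl
         (invFact (suc n)) recurrence (bernoulliNumber (suc n)) ⟩
  invFact (suc n) * (recurrence + bernoulliNumber (suc n))
    ≡⟨ cong (λ b → invFact (suc n) * (recurrence + b)) (bernoulliNumber-suc n) ⟩
  invFact (suc n) * (recurrence + - recurrence)
    ≡⟨ cong (invFact (suc n) *_) (+-inverseʳ recurrence) ⟩
  invFact (suc n) * 0ℚ
    ≡⟨ *-zeroʳ (invFact (suc n)) ⟩
  0ℚ ∎
  where
  c : ℕ → ℚ
  c k = (suc n C k) ÷ (suc n ∸ k +ℕ 1)
  recurrence : ℚ
  recurrence = sumBelow (suc n) (λ k → c k * bernoulliNumber k)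
  term : ∀ k → k < suc n → bernoulliSeries k * expm1/t (suc n ∸ k) ≡ invFact (suc n) * (c k * bernoulliNumber k)
  term k k<1+n = begin
    bernoulliNumber k * invFact k * invFact (suc (suc n ∸ k))
      ≡⟨ *-assoc (bernoulliNumber k) _ _ ⟩
    bernoulliNumber k * (invFact k * invFact (suc (suc n ∸ k)))
      ≡⟨ cong (bernoulliNumber k *_) (invFact*invFact[1+]≡invFact*nCk/[1+] (suc n) k (ℕ.<⇒≤ k<1+n)) ⟩
    bernoulliNumber k * (invFact (suc n) * c k)
      ≡⟨ solve 3 (λ b p c → b :* (p :* c) := p :* (c :* b)) refl (bernoulliNumber k) (invFact (suc n)) (c k) ⟩
    invFact (suc n) * (c k * bernoulliNumber k) ∎

bernoulliPolySeries : ℕ → ℚ → Series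
bernoulliPolySeries r x = egf (λ k → bernoulliPolyOrder r k x)

bernoulliPolySeries-suc : ∀ r x → bernoulliPolySeries (suc r) x ≈ₛ bernoulliSeries ⋆ bernoulliPolySeries r x
bernoulliPolySeries-suc r x n = trans (sym (*-comm (invFact n) _))
  (egf-binomialConvolution bernoulliNumber (λ m → bernoulliPolyOrder r m x) n)

bernoulliPolySeries-1 : ∀ x → bernoulliPolySeries 1 x ≈ₛ bernoulliSeries ⋆ exp x
bernoulliPolySeries-1 = bernoulliPolySeries-suc 0

expm1/t^⋆bernoulliPolySeries : ∀ r x → expm1/t ^ₛ r ⋆ bernoulliPolySeries r x ≈ₛ exp x
expm1/t^⋆bernoulliPolySeries zero    x = ⋆-identityˡ (exp x)
expm1/t^⋆bernoulliPolySeries (suc r) x n = begin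
  ((expm1/t ⋆ E) ⋆ bernoulliPolySeries (suc r) x) n   ≡⟨ ⋆-congˡ (expm1/t ⋆ E) (bernoulliPolySeries-suc r x) n ⟩
  ((expm1/t ⋆ E) ⋆ (bernoulliSeries ⋆ bernoulliPolySeries r x)) n
    ≡⟨ interchange expm1/t E bernoulliSeries (bernoulliPolySeries r x) n ⟩
  ((expm1/t ⋆ bernoulliSeries) ⋆ (E ⋆ bernoulliPolySeries r x)) n
    ≡⟨ ⋆-cong (≈ₛ-trans (⋆-comm expm1/t bernoulliSeries) bernoulliSeries⋆expm1/t≈1)
              (expm1/t^⋆bernoulliPolySeries r x) n ⟩
  (1ₛ ⋆ exp x) n                                      ≡⟨ ⋆-identityˡ (exp x) n ⟩
  exp x n ∎
  where
  E : Series
  E = expm1/t ^ₛ r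
  open CommutativeSemigroupProperties (CommutativeSemiring.*-commutativeSemigroup seriesSemiring)
    using (interchange)

bernoulliPolySeries-1-via-order : ∀ r x →
  (bernoulliSeries ⋆ expm1/t ^ₛ r) ⋆ bernoulliPolySeries r x ≈ₛ bernoulliPolySeries 1 x
bernoulliPolySeries-1-via-order r x n = begin
  ((bernoulliSeries ⋆ expm1/t ^ₛ r) ⋆ bernoulliPolySeries r x) n
    ≡⟨ ⋆-assoc bernoulliSeries (expm1/t ^ₛ r) (bernoulliPolySeries r x) n ⟩
  (bernoulliSeries ⋆ (expm1/t ^ₛ r ⋆ bernoulliPolySeries r x)) n
    ≡⟨ ⋆-congˡ bernoulliSeries (expm1/t^⋆bernoulliPolySeries r x) n ⟩
  (bernoulliSeries ⋆ exp x) n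
    ≡⟨ sym (bernoulliPolySeries-1 x n) ⟩
  bernoulliPolySeries 1 x n ∎

-- Δʳ Bₘ(0) = ∑ⱼ C(r,j) (−1)^(r−j) Bₘ(j), the inner sum of the theorem
ΔʳB : ℕ → ℕ → ℚ
ΔʳB r m = sumBelow (suc r) (λ j → ι (r C j) * sign (r ∸ j) * bernoulliPoly m (ι j))

egf-ΔʳB : ∀ r → egf (ΔʳB r) ≈ₛ bernoulliSeries ⋆ expm1 ^ₛ r
egf-ΔʳB r m = begin
  ΔʳB r m * invFact m
    ≡⟨ *-distribʳ-sumBelow (suc r) (invFact m) _ ⟩
  sumBelow (suc r) (λ j → c j * bernoulliPoly m (ι j) * invFact m)
    ≡⟨ sumBelow-cong (suc r) (λ j → trans (*-assoc (c j) _ _) (cong (c j *_) (bernoulliPolySeries-1 (ι j) m))) ⟩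
  sumBelow (suc r) (λ j → c j * (bernoulliSeries ⋆ exp (ι j)) m)
    ≡⟨ sumBelow-cong (suc r) (λ j → *-distribˡ-sumBelow (suc m) (c j) _) ⟩
  sumBelow (suc r) (λ j → sumBelow (suc m) (λ k → c j * (bernoulliSeries k * exp (ι j) (m ∸ k))))
    ≡⟨ sumBelow-comm (suc r) (suc m) _ ⟩
  sumBelow (suc m) (λ k → sumBelow (suc r) (λ j → c j * (bernoulliSeries k * exp (ι j) (m ∸ k))))
    ≡⟨ sumBelow-cong (suc m) (λ k → trans (sumBelow-cong (suc r) (λ j → regroup j k))
                                          (sym (*-distribˡ-sumBelow (suc r) (bernoulliSeries k) _))) ⟩
  sumBelow (suc m) (λ k → bernoulliSeries k * sumBelow (suc r) (λ j → ι (r C j) * (sign (r ∸ j) * exp (ι j) (m ∸ k))))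
    ≡⟨ sumBelow-cong (suc m) (λ k → cong (bernoulliSeries k *_) (sym (expm1^-binomial r (m ∸ k)))) ⟩
  (bernoulliSeries ⋆ expm1 ^ₛ r) m ∎
  where
  c : ℕ → ℚ
  c j = ι (r C j) * sign (r ∸ j)
  regroup : ∀ j k → c j * (bernoulliSeries k * exp (ι j) (m ∸ k))
                  ≡ bernoulliSeries k * (ι (r C j) * (sign (r ∸ j) * exp (ι j) (m ∸ k)))
  regroup j k = solve 4 (λ a s b e → (a :* s) :* (b :* e) := b :* (a :* (s :* e))) refl
    (ι (r C j)) (sign (r ∸ j)) (bernoulliSeries k) (exp (ι j) (m ∸ k))

egf-ΔʳB-below : ∀ r m → m < r → egf (ΔʳB r) m ≡ 0ℚ
egf-ΔʳB-below r m m<r = trans (egf-ΔʳB r m) (⋆-below bernoulliSeries (expm1 ^ₛ r) (expm1^-below r) m<r)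

egf-ΔʳB-shift : ∀ r p → egf (ΔʳB r) (p +ℕ r) ≡ (bernoulliSeries ⋆ expm1/t ^ₛ r) p
egf-ΔʳB-shift r p = begin
  egf (ΔʳB r) (p +ℕ r)                                  ≡⟨ egf-ΔʳB r (p +ℕ r) ⟩
  (bernoulliSeries ⋆ expm1 ^ₛ r) (p +ℕ r)               ≡⟨ ⋆-shift bernoulliSeries (expm1 ^ₛ r) r p (expm1^-below r) ⟩
  (bernoulliSeries ⋆ (λ i → (expm1 ^ₛ r) (i +ℕ r))) p   ≡⟨ ⋆-congˡ bernoulliSeries (expm1^-shift r) p ⟩
  (bernoulliSeries ⋆ expm1/t ^ₛ r) p                    ∎


*≢0 : ∀ {m n} → m ≢ 0 → n ≢ 0 → m *ℕ n ≢ 0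
*≢0 {m} m≢0 n≢0 m*n≡0 = [ m≢0 , n≢0 ]′ (ℕ.m*n≡0⇒m≡0∨n≡0 m m*n≡0)

lowerCoefficient : ∀ n r k → k < r →
  (r C k) ÷ ((r !) *ℕ ((n +ℕ r ∸ k) C (r ∸ k))) ≡ ι (n !) * (invFact k * invFact (n +ℕ r ∸ k))
lowerCoefficient n r k k<r = ÷≡n!/[k!m!] (r C k) _ n k m (*≢0 (n!≢0 r) (nCk≢0 b≤m))
  (*ι-cancelʳ (b !) (n!≢0 b) (begin
    ι (n !) * ι ((r !) *ℕ (m C b)) * ι (b !)       ≡⟨ cong (λ z → ι (n !) * z * ι (b !)) (ι-homo-* (r !) _) ⟩
    ι (n !) * (ι (r !) * ι (m C b)) * ι (b !)
      ≡⟨ solve 4 (λ a c d e → a :* (c :* d) :* e := c :* (d :* (e :* a))) refl (ι (n !)) (ι (r !)) (ι (m C b)) (ι (b !)) ⟩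
    ι (r !) * (ι (m C b) * (ι (b !) * ι (n !)))
      ≡⟨ cong (λ l → ι (r !) * (ι (m C b) * (ι (b !) * ι (l !)))) (sym m∸b≡n) ⟩
    ι (r !) * (ι (m C b) * (ι (b !) * ι ((m ∸ b) !))) ≡⟨ cong (ι (r !) *_) (ι-nCk*k!*[n∸k]!≡n! b≤m) ⟩
    ι (r !) * ι (m !)                             ≡⟨ cong (_* ι (m !)) (sym (ι-nCk*k!*[n∸k]!≡n! k≤r)) ⟩
    ι (r C k) * (ι (k !) * ι (b !)) * ι (m !)
      ≡⟨ solve 4 (λ c u v w → c :* (u :* v) :* w := c :* (u :* w) :* v) refl (ι (r C k)) (ι (k !)) (ι (b !)) (ι (m !)) ⟩
    ι (r C k) * (ι (k !) * ι (m !)) * ι (b !)     ∎))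
  where
  k≤r : k ≤ r
  k≤r = ℕ.<⇒≤ k<r
  m b : ℕ
  m = n +ℕ r ∸ k
  b = r ∸ k
  m≡n+b : m ≡ n +ℕ b
  m≡n+b = ℕ.+-∸-assoc n k≤r
  b≤m : b ≤ m
  b≤m = subst (b ≤_) (sym m≡n+b) (ℕ.m≤n+m b n)
  m∸b≡n : m ∸ b ≡ n
  m∸b≡n = trans (cong (_∸ b) m≡n+b) (ℕ.m+n∸n≡m n b)

upperCoefficient : ∀ n r k → r ≤ k → k ≤ n →
  (n C (k ∸ r)) ÷ ((r !) *ℕ (k C r)) ≡ ι (n !) * (invFact k * invFact (n +ℕ r ∸ k))
upperCoefficient n r k r≤k k≤n = ÷≡n!/[k!m!] (n C d) _ n k m (*≢0 (n!≢0 r) (nCk≢0 r≤k))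
  (*ι-cancelʳ (d !) (n!≢0 d) (begin
    ι (n !) * ι ((r !) *ℕ (k C r)) * ι (d !)       ≡⟨ cong (λ z → ι (n !) * z * ι (d !)) (ι-homo-* (r !) _) ⟩
    ι (n !) * (ι (r !) * ι (k C r)) * ι (d !)
      ≡⟨ solve 4 (λ a c e f → a :* (c :* e) :* f := a :* (e :* (c :* f))) refl (ι (n !)) (ι (r !)) (ι (k C r)) (ι (d !)) ⟩
    ι (n !) * (ι (k C r) * (ι (r !) * ι (d !)))   ≡⟨ cong (ι (n !) *_) (ι-nCk*k!*[n∸k]!≡n! r≤k) ⟩
    ι (n !) * ι (k !)                             ≡⟨ cong (_* ι (k !)) (sym (ι-nCk*k!*[n∸k]!≡n! d≤n)) ⟩
    ι (n C d) * (ι (d !) * ι ((n ∸ d) !)) * ι (k !)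
      ≡⟨ cong (λ l → ι (n C d) * (ι (d !) * ι (l !)) * ι (k !)) (sym m≡n∸d) ⟩
    ι (n C d) * (ι (d !) * ι (m !)) * ι (k !)
      ≡⟨ solve 4 (λ c u v w → c :* (u :* v) :* w := c :* (w :* v) :* u) refl (ι (n C d)) (ι (d !)) (ι (m !)) (ι (k !)) ⟩
    ι (n C d) * (ι (k !) * ι (m !)) * ι (d !)     ∎))
  where
  d m : ℕ
  d = k ∸ r
  m = n +ℕ r ∸ k
  d≤n : d ≤ n
  d≤n = ℕ.≤-trans (ℕ.m∸n≤m k r) k≤n
  m≡n∸d : m ≡ n ∸ d
  m≡n∸d = begin
    n +ℕ r ∸ k            ≡⟨ cong (n +ℕ r ∸_) (sym (ℕ.m∸n+n≡m r≤k)) ⟩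
    n +ℕ r ∸ (d +ℕ r)     ≡⟨ cong₂ _∸_ (ℕ.+-comm n r) (ℕ.+-comm d r) ⟩
    r +ℕ n ∸ (r +ℕ d)     ≡⟨ ℕ.[m+n]∸[m+o]≡n∸o r n d ⟩
    n ∸ d                 ∎


ΔʳB-convolution : ∀ n r x →
  sumBelow (suc n) (λ k → egf (ΔʳB r) (n +ℕ r ∸ k) * bernoulliPolySeries r x k) ≡ bernoulliPolySeries 1 x n
ΔʳB-convolution n r x = begin
  sumBelow (suc n) (λ k → egf (ΔʳB r) (n +ℕ r ∸ k) * bernoulliPolySeries r x k)
    ≡⟨ sumBelow-cong-< (suc n) shifted ⟩
  (bernoulliPolySeries r x ⋆ G) n  ≡⟨ ⋆-comm (bernoulliPolySeries r x) G n ⟩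
  (G ⋆ bernoulliPolySeries r x) n  ≡⟨ bernoulliPolySeries-1-via-order r x n ⟩
  bernoulliPolySeries 1 x n        ∎
  where
  G : Series
  G = bernoulliSeries ⋆ expm1/t ^ₛ r
  shifted : ∀ k → k < suc n →
    egf (ΔʳB r) (n +ℕ r ∸ k) * bernoulliPolySeries r x k ≡ bernoulliPolySeries r x k * G (n ∸ k)
  shifted k (s≤s k≤n) = begin
    egf (ΔʳB r) (n +ℕ r ∸ k) * bernoulliPolySeries r x k
      ≡⟨ cong (λ l → egf (ΔʳB r) l * bernoulliPolySeries r x k) (ℕ.+-∸-comm r k≤n) ⟩
    egf (ΔʳB r) (n ∸ k +ℕ r) * bernoulliPolySeries r x k
      ≡⟨ cong (_* bernoulliPolySeries r x k) (egf-ΔʳB-shift r (n ∸ k)) ⟩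
    G (n ∸ k) * bernoulliPolySeries r x k
      ≡⟨ *-comm (G (n ∸ k)) _ ⟩
    bernoulliPolySeries r x k * G (n ∸ k) ∎

-- The identity also holds for r = 0.
theorem5 : (n r : ℕ) → 1 ≤ r → (x : ℚ) →
    bernoulliPoly n x ≡
      sumBelow r (λ k →
          ((r C k) ÷ ((r !) *ℕ ((n +ℕ r ∸ k) C (r ∸ k))))
          * sumFromTo 0 r (λ j → ((r C j) ÷ 1) * sign (r ∸ j) * bernoulliPoly (n +ℕ r ∸ k) (j ÷ 1))
          * bernoulliPolyOrder r k x)
      + sumFromTo r n (λ k →
          ((n C (k ∸ r)) ÷ ((r !) *ℕ (k C r)))
          * sumFromTo 0 r (λ j → ((r C j) ÷ 1) * sign (r ∸ j) * bernoulliPoly (n +ℕ r ∸ k) (j ÷ 1))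
          * bernoulliPolyOrder r k x)
theorem5 n r _ x = begin
  bernoulliPoly n x
    ≡⟨ b≡n!*egf (bernoulliPoly n x) ⟩
  ι (n !) * bernoulliPolySeries 1 x n
    ≡⟨ cong (ι (n !) *_) (sym (ΔʳB-convolution n r x)) ⟩
  ι (n !) * sumBelow (suc n) term
    ≡⟨ cong (ι (n !) *_) (sym (sumBelow+sumFromTo r n term gap)) ⟩
  ι (n !) * (sumBelow r term + sumFromTo r n term)
    ≡⟨ *-distribˡ-+ (ι (n !)) _ _ ⟩
  ι (n !) * sumBelow r term + ι (n !) * sumFromTo r n term
    ≡⟨ cong₂ _+_ (*-distribˡ-sumBelow r (ι (n !)) term) (*-distribˡ-sumBelow (suc n ∸ r) (ι (n !)) _) ⟩
  sumBelow r (λ k → ι (n !) * term k) + sumFromTo r n (λ k → ι (n !) * term k)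
    ≡⟨ cong₂ _+_ (sumBelow-cong-< r (λ k k<r → sym (scaled {k} (lowerCoefficient n r k k<r))))
                 (sumFromTo-cong r n (λ k r≤k k≤n → sym (scaled {k} (upperCoefficient n r k r≤k k≤n)))) ⟩
  sumBelow r (λ k → lower k * ΔʳB r (n +ℕ r ∸ k) * bernoulliPolyOrder r k x)
    + sumFromTo r n (λ k → upper k * ΔʳB r (n +ℕ r ∸ k) * bernoulliPolyOrder r k x) ∎
  where
  lower upper : ℕ → ℚ
  lower k = (r C k) ÷ ((r !) *ℕ ((n +ℕ r ∸ k) C (r ∸ k)))
  upper k = (n C (k ∸ r)) ÷ ((r !) *ℕ (k C r))
  term : ℕ → ℚ
  term k = egf (ΔʳB r) (n +ℕ r ∸ k) * bernoulliPolySeries r x k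
  b≡n!*egf : ∀ b → b ≡ ι (n !) * (b * invFact n)
  b≡n!*egf b = begin
    b                                ≡⟨ sym (*-identityʳ b) ⟩
    b * 1ℚ                           ≡⟨ cong (b *_) (sym (invFact*n!≡1 n)) ⟩
    b * (invFact n * ι (n !))        ≡⟨ solve 3 (λ b p f → b :* (p :* f) := f :* (b :* p)) refl b (invFact n) (ι (n !)) ⟩
    ι (n !) * (b * invFact n)        ∎
  scaled : ∀ {k c} → c ≡ ι (n !) * (invFact k * invFact (n +ℕ r ∸ k)) →
           c * ΔʳB r (n +ℕ r ∸ k) * bernoulliPolyOrder r k x ≡ ι (n !) * term k
  scaled {k} refl = solve 5 (λ f p q d b → f :* (p :* q) :* d :* b := f :* ((d :* q) :* (b :* p))) refl
    (ι (n !)) (invFact k) (invFact (n +ℕ r ∸ k)) (ΔʳB r (n +ℕ r ∸ k)) (bernoulliPolyOrder r k x)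
  gap : ∀ k → n < k → k < r → term k ≡ 0ℚ
  gap k n<k k<r = trans (cong (_* bernoulliPolySeries r x k) (egf-ΔʳB-below r (n +ℕ r ∸ k) n+r∸k<r))
                        (*-zeroˡ (bernoulliPolySeries r x k))
    where
    n+r∸k<r : n +ℕ r ∸ k < r
    n+r∸k<r = subst (n +ℕ r ∸ k <_) (ℕ.m+n∸m≡n n r)
      (ℕ.∸-monoʳ-< n<k (ℕ.≤-trans (ℕ.<⇒≤ k<r) (ℕ.m≤n+m r n)))
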